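{- For every positive integer $k$ and every real $\rho>1$ there is a graph $G$ with edge density at most $\rho$ such that Broadcast on $G$ is solvable with $k'$ ignorant agents if and only if $k'\ge k$.
   Context: The edge density of a graph with $n$ nodes and $m$ edges is $m/n$. The Broadcast problem: a connected base graph $G=(V,E)$ is given and time proceeds in synchronous rounds. In each round the adversary first removes a (possibly empty) set $E'\subseteq E$ such that $(V,E\setminus E')$ is connected; then each agent, after local computation and communication with agents at the same node, either stays or moves along one edge of $E\setminus E'$ incident to its node; all agents move simultaneously. Agents have unique IDs, local memory, and full knowledge at every round of $G$, the current edge set, and the positions and knowledge status of all agents. Initially one source agent holding a message $\mathcal M$ and $k\ge 1$ ignorant agents are placed at distinct nodes, the placement chosen by the adversary. An ignorant agent becomes a source agent when at the same node as a source agent. Broadcast is solvable on $G$ with $k$ ignorant agents if the agents have a strategy that, for every initial placement and every adversary behavior, makes all agents source agents within finitely many rounds.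
   Formalization: The density bound ρ ranges only over the rationals greater than 1 instead of the reals. -}

module Defs where

open import Data.Nat using (ℕ; zero; suc; _*_; _≤_; _<_)
open import Data.Fin using (Fin; zero; suc; _≟_)
open import Data.Bool using (Bool; true; false; _∨_; _∧_)
open import Data.List using (List; []; _∷_; allFin)
open import Data.Bool.ListAction using (any)
open import Data.Product using (Σ; _×_; _,_; proj₁; proj₂; ∃)
open import Data.Sum using (_⊎_)
open import Function using (Injective)
open import Relation.Nullary using (¬_)
open import Relation.Nullary.Decidable using (⌊_⌋)
open import Relation.Binary.PropositionalEquality using (_≡_; _≢_)

SameEdge : {n : ℕ} → Fin n × Fin n → Fin n × Fin n → Set
SameEdge (a , b) (c , d) = (a ≡ c × b ≡ d) ⊎ (a ≡ d × b ≡ c)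

record Graph : Set where
  field
    n        : ℕ
    m        : ℕ
    ends     : Fin m → Fin n × Fin n
    loopless : ∀ e → proj₁ (ends e) ≢ proj₂ (ends e)
    noMulti  : ∀ e e′ → SameEdge (ends e) (ends e′) → e ≡ e′

module _ (G : Graph) where
  open Graph G

  EdgeSet : Set
  EdgeSet = Fin m → Bool

  allEdges : EdgeSet
  allEdges _ = true

  Adj : EdgeSet → Fin n → Fin n → Set
  Adj al u v = Σ (Fin m) λ e → al e ≡ true × SameEdge (ends e) (u , v)

  data Reach (al : EdgeSet) (u : Fin n) : Fin n → Set where
    here : Reach al u u
    step : ∀ {v w} → Reach al u v → Adj al v w → Reach al u w

  Connected : EdgeSet → Set
  Connected al = ∀ u v → Reach al u v

  -- Agents: Fin (suc k); agent zero is the initial source, the other k are ignorant.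
  Pos : ℕ → Set
  Pos k = Fin (suc k) → Fin n

  -- Full observable history: list of (positions at start of round, edges present
  -- in that round), most recent first.
  History : ℕ → Set
  History k = List (Pos k × EdgeSet)

  Strategy : ℕ → Set
  Strategy k = History k → Pos k → EdgeSet → Pos k

  -- Adversary: the edge set E ∖ E′ left in each round.
  Adversary : Set
  Adversary = ℕ → EdgeSet

  ValidAdversary : Adversary → Set
  ValidAdversary A = ∀ t → Connected (A t)

  LegalMove : {k : ℕ} → EdgeSet → Pos k → Pos k → Set
  LegalMove al p p′ = ∀ a → p′ a ≡ p a ⊎ Adj al (p a) (p′ a)

  module Run {k : ℕ} (σ : Strategy k) (p₀ : Pos k) (A : Adversary) where
    state : ℕ → Pos k × History k
    state zero = p₀ , []
    state (suc t) with state t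
    ... | p , h = σ h p (A t) , (p , A t) ∷ h

    pos : ℕ → Pos k
    pos t = proj₁ (state t)

    isSource₀ : Fin (suc k) → Bool
    isSource₀ zero = true
    isSource₀ (suc _) = false

    -- knowledge status at the start of round t (after the meetings of round t-1)
    informed : ℕ → Fin (suc k) → Bool
    informed zero a = isSource₀ a
    informed (suc t) a =
      informed t a ∨ any (λ b → informed t b ∧ ⌊ pos (suc t) b ≟ pos (suc t) a ⌋) (allFin (suc k))

    AllInformed : ℕ → Set
    AllInformed t = ∀ a → informed t a ≡ true

  BroadcastSolvable : ℕ → Set
  BroadcastSolvable k =
    Σ (Strategy k) λ σ →
      ∀ (p₀ : Pos k) → Injective _≡_ _≡_ p₀ →
      ∀ (A : Adversary) → ValidAdversary A →
        (∀ t → LegalMove (A t) (Run.pos σ p₀ A t) (Run.pos σ p₀ A (suc t)))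
        × ∃ λ t → Run.AllInformed σ p₀ A t

EdgeDensity≤ : Graph → ℕ → ℕ → Set
EdgeDensity≤ G p q = Graph.m G * q ≤ p * Graph.n G

-- The graph is a windmill: k triangles hub–petal–petal sharing the hub, plus k·q pendant
-- leaves at the hub, so that m / n = (3k + kq) / (1 + 2k + kq) < (q + 1) / q ≤ p / q.
--
-- With k′ < k ignorant agents, agent a starts on a petal of its own triangle, and in every
-- round the adversary removes the spoke to the petal where the owner of a triangle stands.
-- The graph stays connected, each agent is confined to its triangle, and nobody ever meets
-- the source.
--
-- With k′ ≥ k ignorant agents, an informed and an ignorant agent meet whenever they can do
-- so in one round; otherwise everybody retreats towards the hub, and an agent trapped on a
-- petal crosses to the other petal unless it is the least agent there. An agent on the hub
-- always allows a meeting; an agent on a leaf, or agents on both petals of a triangle, put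
-- somebody on the hub after one retreat; and if a retreat leaves the hub empty, pigeonhole
-- traps two of the k′ + 1 > k agents in one triangle, which gives the previous situation.
-- So the number of ignorant agents drops at least once every three rounds.

module Submission where

open import Defs
open import Data.Bool using (Bool; true; false; not; T; if_then_else_; _∧_; _∨_)
open import Data.Bool.ListAction using (any; or)
open import Data.Bool.Properties
  using (T-≡; T-∧; ¬-not; not-¬; not-involutive; ∨-zeroʳ) renaming (_≟_ to _≟ᵇ_)
open import Data.Empty using (⊥-elim)
open import Data.Fin using (Fin; zero; suc; _≟_; inject≤) renaming (_<_ to _<ᶠ_)
open import Data.Fin.Induction using (<-wellFounded)
open import Data.Fin.Properties
  using (any?; pigeonhole; 0≢1+n; inject≤-injective; 1↔⊤; 2↔Bool; +↔⊎; *↔×) renaming (_<?_ to _<ᶠ?_)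
open import Data.Fin.Subset using (_∈_; _⊂_; ⊤; ∣_∣)
open import Data.Fin.Subset.Properties
  using (p⊆q⇒∣p∣≤∣q∣; p⊂q⇒∣p∣<∣q∣; ∣p∣≤n; ∣p∣≡n⇒p≡⊤; ∣⊤∣≡n; ∈⊤)
open import Data.List using ([]; _∷_; allFin)
open import Data.List.Properties using (map-cong)
open import Data.List.Membership.Propositional using (lose)
open import Data.List.Membership.Propositional.Properties using (∈-allFin)
open import Data.List.Relation.Unary.Any using (satisfied)
open import Data.List.Relation.Unary.Any.Properties using (any⁺; any⁻)
open import Data.Nat using (ℕ; zero; suc; _+_; _*_; _∸_; _≤_; _<_; z≤n; s≤s; s≤s⁻¹)
open import Data.Nat.Properties
  using ( ≤-refl; ≤-trans; ≤-<-trans; <-≤-trans; ≤-antisym; ≮⇒≥; n≤0⇒n≡0; +-suc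
        ; m≤m+n; *-monoˡ-≤; ∸-monoʳ-≤; ∸-monoʳ-<; m≤n⇒m∸n≡0; m∸n≡0⇒m≤n; module ≤-Reasoning)
open import Data.Nat.Tactic.RingSolver using (solve-∀)
open import Data.Product
  using (Σ; _×_; _,_; proj₁; proj₂; ∃; ∃₂; map₂; swap) renaming (map to map-×)
open import Data.Product.Function.NonDependent.Propositional using (_×-↔_)
open import Data.Sum using (_⊎_; inj₁; inj₂; [_,_]; [_,_]′)
import Data.Sum as Sum
open import Data.Sum.Function.Propositional using (_⊎-↔_)
open import Data.Unit using (tt) renaming (⊤ to Unit)
open import Data.Vec using (tabulate)
open import Data.Vec.Properties using (lookup∘tabulate; lookup⇒[]=; []=⇒lookup)
open import Function using (_∘_; Inverse; Injective)
open import Function.Bundles using (_⇔_; _↔_; mk⇔; mk↔ₛ′; Equivalence)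
open import Function.Properties.Inverse using (↔-refl; ↔-sym; ↔-trans)
open import Induction.WellFounded using (Acc; acc)
open import Relation.Nullary using (¬_; Dec; yes; no; does)
open import Relation.Nullary.Decidable
  using (⌊_⌋; dec-true; dec-false; toWitness; fromWitness; _×-dec_; _⊎-dec_)
open import Relation.Binary.PropositionalEquality
  using (_≡_; _≢_; refl; sym; trans; cong; cong₂; subst; module ≡-Reasoning)

by-sides : ∀ {P : Bool → Set} b → P b → P (not b) → ∀ c → P c
by-sides false p _ false = p
by-sides false _ q true  = q
by-sides true  _ q false = q
by-sides true  p _ true  = p

Knowledge : ℕ → Set
Knowledge n = Fin n → Bool

module _ {n : ℕ} where

  -- Opaque so that unification treats ignorance as rigid instead of unfolding the count.
  opaque
    ignorance : Knowledge n → ℕ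
    ignorance I = n ∸ ∣ tabulate I ∣

  ∈-tabulate⁺ : ∀ {I : Knowledge n} {x} → I x ≡ true → x ∈ tabulate I
  ∈-tabulate⁺ {I} {x} Ix = lookup⇒[]= x (tabulate I) (trans (lookup∘tabulate I x) Ix)

  ∈-tabulate⁻ : ∀ {I : Knowledge n} {x} → x ∈ tabulate I → I x ≡ true
  ∈-tabulate⁻ {I} {x} x∈ = trans (sym (lookup∘tabulate I x)) ([]=⇒lookup x∈)

  opaque
    unfolding ignorance

    ignorance-antitone : ∀ {I J : Knowledge n} → (∀ {a} → I a ≡ true → J a ≡ true) →
                         ignorance J ≤ ignorance I
    ignorance-antitone {I} {J} I⊆J = ∸-monoʳ-≤ n (p⊆q⇒∣p∣≤∣q∣ (∈-tabulate⁺ ∘ I⊆J ∘ ∈-tabulate⁻))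

    ignorance-drops : ∀ {I J : Knowledge n} {y} → (∀ {a} → I a ≡ true → J a ≡ true) →
                      I y ≡ false → J y ≡ true → ignorance J < ignorance I
    ignorance-drops {I} {J} {y} I⊆J Iy Jy = ∸-monoʳ-< (p⊂q⇒∣p∣<∣q∣ I⊂J) (∣p∣≤n (tabulate J))
      where
      I⊂J : tabulate I ⊂ tabulate J
      I⊂J = ∈-tabulate⁺ ∘ I⊆J ∘ ∈-tabulate⁻ , y , ∈-tabulate⁺ Jy ,
            λ y∈ → not-¬ (∈-tabulate⁻ y∈) Iy

    ignorance≡0⁺ : ∀ {I : Knowledge n} → (∀ a → I a ≡ true) → ignorance I ≡ 0
    ignorance≡0⁺ {I} everyone = m≤n⇒m∸n≡0 (begin
      n                ≡⟨ sym (∣⊤∣≡n n) ⟩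
      ∣ ⊤ {n} ∣        ≤⟨ p⊆q⇒∣p∣≤∣q∣ {p = ⊤} (λ _ → ∈-tabulate⁺ (everyone _)) ⟩
      ∣ tabulate I ∣   ∎)
      where open ≤-Reasoning

    ignorance≡0⁻ : ∀ {I : Knowledge n} → ignorance I ≡ 0 → ∀ a → I a ≡ true
    ignorance≡0⁻ {I} none a = ∈-tabulate⁻ (subst (a ∈_) (sym everyone) ∈⊤)
      where
      everyone : tabulate I ≡ ⊤
      everyone = ∣p∣≡n⇒p≡⊤ (≤-antisym (∣p∣≤n (tabulate I)) (m∸n≡0⇒m≤n none))

module _ (G : Graph) where
  open Graph G

  Step : EdgeSet G → Fin n → Fin n → Set
  Step al u w = w ≡ u ⊎ Adj G al u w

  sameEdge? : (e f : Fin n × Fin n) → Dec (SameEdge e f)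
  sameEdge? (a , b) (c , d) = ((a ≟ c) ×-dec (b ≟ d)) ⊎-dec ((a ≟ d) ×-dec (b ≟ c))

  adj? : ∀ al u v → Dec (Adj G al u v)
  adj? al u v = any? λ e → (al e ≟ᵇ true) ×-dec sameEdge? (ends e) (u , v)

  step? : ∀ al u w → Dec (Step al u w)
  step? al u w = (w ≟ u) ⊎-dec adj? al u w

  Meetable : EdgeSet G → Fin n → Fin n → Set
  Meetable al u v = ∃ λ w → Step al u w × Step al v w

  meetable? : ∀ al u v → Dec (Meetable al u v)
  meetable? al u v = any? λ w → step? al u w ×-dec step? al v w

  adj-sym : ∀ {al u v} → Adj G al u v → Adj G al v u
  adj-sym (e , present , inj₁ same) = e , present , inj₂ same
  adj-sym (e , present , inj₂ swapped) = e , present , inj₁ swapped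

  reach-trans : ∀ {al u v w} → Reach G al u v → Reach G al v w → Reach G al u w
  reach-trans r here = r
  reach-trans r (step r′ a) = step (reach-trans r r′) a

  reach-sym : ∀ {al u v} → Reach G al u v → Reach G al v u
  reach-sym here = here
  reach-sym (step r a) = reach-trans (step here (adj-sym a)) (reach-sym r)

  connected-from : ∀ {al} r → (∀ v → Reach G al r v) → Connected G al
  connected-from r reach u v = reach-trans (reach-sym (reach u)) (reach v)

  reach-closed : ∀ {al u v} (S : Fin n → Set) → (∀ {x y} → Adj G al x y → S x → S y) →
                 S u → Reach G al u v → S v
  reach-closed S closed su here = su
  reach-closed S closed su (step r a) = closed a (reach-closed S closed su r)

  spread : ∀ {k} → Knowledge (suc k) → Pos G k → Knowledge (suc k)
  spread I p a = I a ∨ any (λ b → I b ∧ ⌊ p b ≟ p a ⌋) (allFin _)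

  spread-⊇ : ∀ {k} (I : Knowledge (suc k)) p {a} → I a ≡ true → spread I p a ≡ true
  spread-⊇ I p Ia rewrite Ia = refl

  spread-meet : ∀ {k} (I : Knowledge (suc k)) p {x y} → I x ≡ true → p x ≡ p y → spread I p y ≡ true
  spread-meet {k} I p {x} {y} Ix same = begin
    I y ∨ any f (allFin _) ≡⟨ cong (I y ∨_) (Equivalence.to T-≡ (any⁺ f (lose (∈-allFin x) fx))) ⟩
    I y ∨ true             ≡⟨ ∨-zeroʳ (I y) ⟩
    true                   ∎
    where
    open ≡-Reasoning
    f : Fin (suc k) → Bool
    f b = I b ∧ ⌊ p b ≟ p y ⌋
    fx : T (f x)
    fx = Equivalence.from T-∧ (Equivalence.from T-≡ Ix , fromWitness same)

  spread-progress : ∀ {k} (I : Knowledge (suc k)) p {x y} → I x ≡ true → I y ≡ false → p x ≡ p y →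
                    ignorance (spread I p) < ignorance I
  spread-progress I p Ix Iy same = ignorance-drops (spread-⊇ I p) Iy (spread-meet I p Ix same)

  spread⁻ : ∀ {k} (I : Knowledge (suc k)) p a → spread I p a ≡ true →
            I a ≡ true ⊎ ∃ λ b → I b ≡ true × p b ≡ p a
  spread⁻ I p a informed with I a
  ... | true = inj₁ refl
  ... | false with satisfied (any⁻ _ (allFin _) (Equivalence.from T-≡ informed))
  ... | b , found with Equivalence.to T-∧ found
  ... | Ib , met = inj₂ (b , Equivalence.to T-≡ Ib , toWitness met)

  spread-isolated : ∀ {k} (I : Knowledge (suc k)) p {a} → I a ≢ true →
                    (∀ b → I b ≡ true → p b ≢ p a) → spread I p a ≢ true
  spread-isolated I p {a} ignorant apart informed with spread⁻ I p a informed
  ... | inj₁ before                 = ignorant before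
  ... | inj₂ (b , informed-b , same) = apart b informed-b same

  spread-cong : ∀ {k} {I J : Knowledge (suc k)} p → (∀ a → I a ≡ J a) →
                ∀ a → spread I p a ≡ spread J p a
  spread-cong p same a =
    cong₂ _∨_ (same a) (cong or (map-cong (λ b → cong (_∧ _) (same b)) (allFin _)))

  module Adaptive {k} (σ : Strategy G k) (p₀ : Pos G k) (react : Pos G k → EdgeSet G) where

    play : ℕ → Pos G k × History G k
    play zero = p₀ , []
    play (suc t) = σ h p (react p) , (p , react p) ∷ h
      where
      p : Pos G k
      p = proj₁ (play t)
      h : History G k
      h = proj₂ (play t)

    adversary : Adversary G
    adversary t = react (proj₁ (play t))

    run≡play : ∀ t → Run.state G σ p₀ adversary t ≡ play t
    run≡play zero = refl
    run≡play (suc t) rewrite run≡play t = refl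

    adversary-reacts : ∀ t → adversary t ≡ react (Run.pos G σ p₀ adversary t)
    adversary-reacts t = sym (cong (react ∘ proj₁) (run≡play t))

module FiniteGraph {V E : Set} {n m : ℕ} (V↔ : V ↔ Fin n) (E↔ : E ↔ Fin m)
                   (endpoints : E → V × V) where

  ⟦_⟧ : V → Fin n
  ⟦_⟧ = Inverse.to V↔

  node : Fin n → V
  node = Inverse.from V↔

  ⟦_⟧ₑ : E → Fin m
  ⟦_⟧ₑ = Inverse.to E↔

  edge : Fin m → E
  edge = Inverse.from E↔

  ⟦node⟧ : ∀ x → ⟦ node x ⟧ ≡ x
  ⟦node⟧ = Inverse.strictlyInverseˡ V↔

  node⟦⟧ : ∀ v → node ⟦ v ⟧ ≡ v
  node⟦⟧ = Inverse.strictlyInverseʳ V↔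

  ⟦edge⟧ₑ : ∀ e → ⟦ edge e ⟧ₑ ≡ e
  ⟦edge⟧ₑ = Inverse.strictlyInverseˡ E↔

  edge⟦⟧ₑ : ∀ e → edge ⟦ e ⟧ₑ ≡ e
  edge⟦⟧ₑ = Inverse.strictlyInverseʳ E↔

  ⟦⟧-injective : ∀ {u v} → ⟦ u ⟧ ≡ ⟦ v ⟧ → u ≡ v
  ⟦⟧-injective {u} {v} eq = trans (sym (node⟦⟧ u)) (trans (cong node eq) (node⟦⟧ v))

  Joins : E → V → V → Set
  Joins e u v = (proj₁ (endpoints e) ≡ u × proj₂ (endpoints e) ≡ v)
              ⊎ (proj₁ (endpoints e) ≡ v × proj₂ (endpoints e) ≡ u)

  module Simple (loopless : ∀ e → proj₁ (endpoints e) ≢ proj₂ (endpoints e))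
                (simple : ∀ {e e′ u v} → Joins e u v → Joins e′ u v → e ≡ e′) where

    ends : Fin m → Fin n × Fin n
    ends e = ⟦ proj₁ (endpoints (edge e)) ⟧ , ⟦ proj₂ (endpoints (edge e)) ⟧

    joins : ∀ {e u v} → SameEdge (ends e) (⟦ u ⟧ , ⟦ v ⟧) → Joins (edge e) u v
    joins = Sum.map (map-× ⟦⟧-injective ⟦⟧-injective) (map-× ⟦⟧-injective ⟦⟧-injective)

    graph : Graph
    graph = record
      { n = n
      ; m = m
      ; ends = ends
      ; loopless = λ e → loopless (edge e) ∘ ⟦⟧-injective
      ; noMulti = λ e e′ same → begin
          e               ≡⟨ sym (⟦edge⟧ₑ e) ⟩
          ⟦ edge e ⟧ₑ     ≡⟨ cong ⟦_⟧ₑ (simple (joins same) (inj₁ (refl , refl))) ⟩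
          ⟦ edge e′ ⟧ₑ    ≡⟨ ⟦edge⟧ₑ e′ ⟩
          e′              ∎
      }
      where open ≡-Reasoning

    adj⁺ : ∀ {al e u v} → al ⟦ e ⟧ₑ ≡ true → Joins e u v → Adj graph al ⟦ u ⟧ ⟦ v ⟧
    adj⁺ {e = e} {u} {v} present j = ⟦ e ⟧ₑ , present , same
      where
      same : SameEdge (ends ⟦ e ⟧ₑ) (⟦ u ⟧ , ⟦ v ⟧)
      same rewrite edge⟦⟧ₑ e =
        Sum.map (map-× (cong ⟦_⟧) (cong ⟦_⟧)) (map-× (cong ⟦_⟧) (cong ⟦_⟧)) j

    adj⁻ : ∀ {al u w} → Adj graph al ⟦ u ⟧ w →
           ∃₂ λ e v → al ⟦ e ⟧ₑ ≡ true × Joins e u v × w ≡ ⟦ v ⟧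
    adj⁻ {al} {u} {w} (e , present , same) =
      edge e , node w ,
      subst (λ e′ → al e′ ≡ true) (sym (⟦edge⟧ₑ e)) present ,
      joins (subst (λ x → SameEdge (ends e) (⟦ u ⟧ , x)) (sym (⟦node⟧ w)) same) ,
      sym (⟦node⟧ w)

    closed-everywhere : ∀ {al} → Connected graph al → (S : V → Set) →
                        (∀ {e u v} → al ⟦ e ⟧ₑ ≡ true → Joins e u v → S u → S v) →
                        ∀ {u} → S u → ∀ v → S v
    closed-everywhere {al} connected S closed {u} su v =
      subst S (node⟦⟧ v)
            (reach-closed graph (S ∘ node) closed′ (subst S (sym (node⟦⟧ u)) su) (connected ⟦ u ⟧ ⟦ v ⟧))
      where
      closed′ : ∀ {x y} → Adj graph al x y → S (node x) → S (node y)
      closed′ {x} a sx with adj⁻ (subst (λ z → Adj graph al z _) (sym (⟦node⟧ x)) a)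
      ... | e , v , present , j , refl = subst S (sym (node⟦⟧ v)) (closed present j sx)

module Windmill (k L : ℕ) where

  data Node : Set where
    hub   : Node
    petal : Fin k → Bool → Node
    leaf  : Fin L → Node

  data Edge : Set where
    spoke : Fin k → Bool → Edge
    rim   : Fin k → Edge
    stem  : Fin L → Edge

  endpoints : Edge → Node × Node
  endpoints (spoke i b) = hub , petal i b
  endpoints (rim i)     = petal i false , petal i true
  endpoints (stem j)    = hub , leaf j

  petals : Fin (k * 2) ↔ (Fin k × Bool)
  petals = ↔-trans *↔× (↔-refl ×-↔ 2↔Bool)

  Node↔ : Node ↔ Fin (suc (k * 2 + L))
  Node↔ = ↔-trans (mk↔ₛ′ to from to∘from from∘to)
                  (↔-sym (↔-trans +↔⊎ (1↔⊤ ⊎-↔ (↔-trans +↔⊎ (petals ⊎-↔ ↔-refl)))))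
    where
    to : Node → Unit ⊎ ((Fin k × Bool) ⊎ Fin L)
    to hub         = inj₁ tt
    to (petal i b) = inj₂ (inj₁ (i , b))
    to (leaf j)    = inj₂ (inj₂ j)
    from : Unit ⊎ ((Fin k × Bool) ⊎ Fin L) → Node
    from (inj₁ tt)             = hub
    from (inj₂ (inj₁ (i , b))) = petal i b
    from (inj₂ (inj₂ j))       = leaf j
    to∘from : ∀ x → to (from x) ≡ x
    to∘from (inj₁ tt)             = refl
    to∘from (inj₂ (inj₁ (i , b))) = refl
    to∘from (inj₂ (inj₂ j))       = refl
    from∘to : ∀ v → from (to v) ≡ v
    from∘to hub         = refl
    from∘to (petal i b) = refl
    from∘to (leaf j)    = refl

  Edge↔ : Edge ↔ Fin (k * 2 + k + L)
  Edge↔ = ↔-trans (mk↔ₛ′ to from to∘from from∘to)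
                  (↔-sym (↔-trans +↔⊎ ((↔-trans +↔⊎ (petals ⊎-↔ ↔-refl)) ⊎-↔ ↔-refl)))
    where
    to : Edge → ((Fin k × Bool) ⊎ Fin k) ⊎ Fin L
    to (spoke i b) = inj₁ (inj₁ (i , b))
    to (rim i)     = inj₁ (inj₂ i)
    to (stem j)    = inj₂ j
    from : ((Fin k × Bool) ⊎ Fin k) ⊎ Fin L → Edge
    from (inj₁ (inj₁ (i , b))) = spoke i b
    from (inj₁ (inj₂ i))       = rim i
    from (inj₂ j)              = stem j
    to∘from : ∀ x → to (from x) ≡ x
    to∘from (inj₁ (inj₁ (i , b))) = refl
    to∘from (inj₁ (inj₂ i))       = refl
    to∘from (inj₂ j)              = refl
    from∘to : ∀ e → from (to e) ≡ e
    from∘to (spoke i b) = refl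
    from∘to (rim i)     = refl
    from∘to (stem j)    = refl

  open FiniteGraph Node↔ Edge↔ endpoints public

  data Arc : Node → Edge → Node → Set where
    spoke-out : ∀ {i b} → Arc hub (spoke i b) (petal i b)
    spoke-in  : ∀ {i b} → Arc (petal i b) (spoke i b) hub
    rim-cross : ∀ {i b} → Arc (petal i b) (rim i) (petal i (not b))
    stem-out  : ∀ {j} → Arc hub (stem j) (leaf j)
    stem-in   : ∀ {j} → Arc (leaf j) (stem j) hub

  joins⇒arc : ∀ {e u v} → Joins e u v → Arc u e v
  joins⇒arc {spoke i b} (inj₁ (refl , refl)) = spoke-out
  joins⇒arc {spoke i b} (inj₂ (refl , refl)) = spoke-in
  joins⇒arc {rim i}     (inj₁ (refl , refl)) = rim-cross
  joins⇒arc {rim i}     (inj₂ (refl , refl)) = rim-cross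
  joins⇒arc {stem j}    (inj₁ (refl , refl)) = stem-out
  joins⇒arc {stem j}    (inj₂ (refl , refl)) = stem-in

  arc⇒joins : ∀ {e u v} → Arc u e v → Joins e u v
  arc⇒joins spoke-out               = inj₁ (refl , refl)
  arc⇒joins spoke-in                = inj₂ (refl , refl)
  arc⇒joins (rim-cross {b = false}) = inj₁ (refl , refl)
  arc⇒joins (rim-cross {b = true})  = inj₂ (refl , refl)
  arc⇒joins stem-out                = inj₁ (refl , refl)
  arc⇒joins stem-in                 = inj₂ (refl , refl)

  arc-unique : ∀ {e e′ u v} → Arc u e v → Arc u e′ v → e ≡ e′
  arc-unique spoke-out spoke-out = refl
  arc-unique spoke-in  spoke-in  = refl
  arc-unique rim-cross rim-cross = refl
  arc-unique stem-out  stem-out  = refl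
  arc-unique stem-in   stem-in   = refl

  loopless : ∀ e → proj₁ (endpoints e) ≢ proj₂ (endpoints e)
  loopless (spoke i b) ()
  loopless (rim i)     ()
  loopless (stem j)    ()

  open Simple loopless (λ j j′ → arc-unique (joins⇒arc j) (joins⇒arc j′)) public

  windmill : Graph
  windmill = graph

  arc⁺ : ∀ {al e u v} → al ⟦ e ⟧ₑ ≡ true → Arc u e v → Adj windmill al ⟦ u ⟧ ⟦ v ⟧
  arc⁺ {e = e} present a = adj⁺ {e = e} present (arc⇒joins a)

  arc⁻ : ∀ {al u w} → Adj windmill al ⟦ u ⟧ w →
         ∃₂ λ e v → al ⟦ e ⟧ₑ ≡ true × Arc u e v × w ≡ ⟦ v ⟧
  arc⁻ a with adj⁻ a
  ... | e , v , present , j , eq = e , v , present , joins⇒arc j , eq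

  connected-from-hub : ∀ {al} → (∀ v → Reach windmill al ⟦ hub ⟧ ⟦ v ⟧) → Connected windmill al
  connected-from-hub {al} reach = connected-from windmill ⟦ hub ⟧ λ x →
    subst (Reach windmill al ⟦ hub ⟧) (⟦node⟧ x) (reach (node x))

  windmill-connected : Connected windmill (allEdges windmill)
  windmill-connected = connected-from-hub reach
    where
    reach : ∀ v → Reach windmill (allEdges windmill) ⟦ hub ⟧ ⟦ v ⟧
    reach hub         = here
    reach (petal i b) = step here (arc⁺ refl spoke-out)
    reach (leaf j)    = step here (arc⁺ refl stem-out)

  closed⇒hub : ∀ {al} → Connected windmill al → (S : Node → Set) →
               (∀ {e u v} → S u → al ⟦ e ⟧ₑ ≡ true → Arc u e v → S v) → ∀ {u} → S u → S hub
  closed⇒hub connected S closed su =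
    closed-everywhere connected S (λ {e} present j su → closed {e} su present (joins⇒arc j)) su hub

  stem-present : ∀ {al} → Connected windmill al → ∀ j → al ⟦ stem j ⟧ₑ ≡ true
  stem-present {al} connected j =
    ¬-not λ absent → hub≢leaf (closed⇒hub connected (_≡ leaf j) (closed absent) refl)
    where
    hub≢leaf : hub ≢ leaf j
    hub≢leaf ()
    closed : al ⟦ stem j ⟧ₑ ≡ false →
             ∀ {e u v} → u ≡ leaf j → al ⟦ e ⟧ₑ ≡ true → Arc u e v → v ≡ leaf j
    closed absent refl present stem-in = ⊥-elim (not-¬ present absent)

  rim-present : ∀ {al} → Connected windmill al → ∀ {i b} → al ⟦ spoke i b ⟧ₑ ≡ false →
                al ⟦ rim i ⟧ₑ ≡ true
  rim-present {al} connected {i} {b} spoke-absent =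
    ¬-not λ absent → hub≢petal (closed⇒hub connected (_≡ petal i b) (closed absent) refl)
    where
    hub≢petal : hub ≢ petal i b
    hub≢petal ()
    closed : al ⟦ rim i ⟧ₑ ≡ false →
             ∀ {e u v} → u ≡ petal i b → al ⟦ e ⟧ₑ ≡ true → Arc u e v → v ≡ petal i b
    closed absent refl present spoke-in  = ⊥-elim (not-¬ present spoke-absent)
    closed absent refl present rim-cross = ⊥-elim (not-¬ present absent)

  spoke-present : ∀ {al} → Connected windmill al → ∀ {i b} → al ⟦ spoke i b ⟧ₑ ≡ false →
                  al ⟦ spoke i (not b) ⟧ₑ ≡ true
  spoke-present {al} connected {i} {b} spoke-absent =
    ¬-not λ absent →
      hub∉ (closed⇒hub connected InTriangle (closed (by-sides b spoke-absent absent)) (b , refl))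
    where
    InTriangle : Node → Set
    InTriangle v = ∃ λ c → v ≡ petal i c
    hub∉ : ¬ InTriangle hub
    hub∉ (_ , ())
    closed : (∀ c → al ⟦ spoke i c ⟧ₑ ≡ false) →
             ∀ {e u v} → InTriangle u → al ⟦ e ⟧ₑ ≡ true → Arc u e v → InTriangle v
    closed absent (c , refl) present spoke-in  = ⊥-elim (not-¬ present (absent c))
    closed absent (c , refl) present rim-cross = not c , refl

  petal-injective : ∀ {i i′ b b′} → petal i b ≡ petal i′ b′ → i ≡ i′ × b ≡ b′
  petal-injective refl = refl , refl

  module Blocking {k′ : ℕ} (few : suc k′ ≤ k) where

    owned : Fin (suc k′) → Fin k
    owned a = inject≤ a few

    -- Only the owner of triangle i can get a spoke of i removed. Since the owner stands on one
    -- petal at a time, block p is connected for every p, not just along the play.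
    Guards : Pos windmill k′ → Fin k → Bool → Set
    Guards p i b = ∃ λ a → owned a ≡ i × p a ≡ ⟦ petal i b ⟧

    guards? : ∀ p i b → Dec (Guards p i b)
    guards? p i b = any? λ a → (owned a ≟ i) ×-dec (p a ≟ ⟦ petal i b ⟧)

    guards-one-side : ∀ {p i b} → Guards p i b → ¬ Guards p i (not b)
    guards-one-side {p} {i} {b} (a , refl , at) (a′ , same , at′)
      with inject≤-injective few few a′ a same
    ... | refl = not-¬ refl (proj₂ (petal-injective (⟦⟧-injective (trans (sym at) at′))))

    keep : Pos windmill k′ → Edge → Bool
    keep p (spoke i b) = not (does (guards? p i b))
    keep p (rim i)     = true
    keep p (stem j)    = true

    block : Pos windmill k′ → EdgeSet windmill
    block p e = keep p (edge e)

    block-keeps : ∀ p e → block p ⟦ e ⟧ₑ ≡ keep p e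
    block-keeps p e = cong (keep p) (edge⟦⟧ₑ e)

    unguarded-kept : ∀ p {i b} → ¬ Guards p i b → block p ⟦ spoke i b ⟧ₑ ≡ true
    unguarded-kept p {i} {b} free =
      trans (block-keeps p (spoke i b)) (cong not (dec-false (guards? p i b) free))

    kept-unguarded : ∀ p {i b} → block p ⟦ spoke i b ⟧ₑ ≡ true → ¬ Guards p i b
    kept-unguarded p {i} {b} kept g =
      not-¬ kept (trans (block-keeps p (spoke i b)) (cong not (dec-true (guards? p i b) g)))

    block-connected : ∀ p → Connected windmill (block p)
    block-connected p = connected-from-hub reach
      where
      reach : ∀ v → Reach windmill (block p) ⟦ hub ⟧ ⟦ v ⟧
      reach hub = here
      reach (leaf j) = step here (arc⁺ (block-keeps p (stem j)) stem-out)
      reach (petal i b) with guards? p i b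
      ... | no free = step here (arc⁺ (unguarded-kept p free) spoke-out)
      ... | yes g = step (step here (arc⁺ (unguarded-kept p (guards-one-side g)) spoke-out))
                         (subst (λ c → Adj windmill (block p) ⟦ petal i (not b) ⟧ ⟦ petal i c ⟧)
                                (not-involutive b) (arc⁺ (block-keeps p (rim i)) rim-cross))

    start : Pos windmill k′
    start a = ⟦ petal (owned a) false ⟧

    start-injective : Injective _≡_ _≡_ start
    start-injective same = inject≤-injective few few _ _ (proj₁ (petal-injective (⟦⟧-injective same)))

    confined : ∀ p {a b w} → p a ≡ ⟦ petal (owned a) b ⟧ → Step windmill (block p) (p a) w →
               ∃ λ c → w ≡ ⟦ petal (owned a) c ⟧
    confined p {a} {b} at (inj₁ stay) = b , trans stay at
    confined p {a} {b} at (inj₂ moved)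
      with arc⁻ {u = petal (owned a) b} (subst (λ x → Adj windmill (block p) x _) at moved)
    ... | _ , _ , present , spoke-in , _  = ⊥-elim (kept-unguarded p present (a , refl , at))
    ... | _ , _ , _ , rim-cross , arrived = not b , arrived

    module Against (σ : Strategy windmill k′) where
      open Adaptive windmill σ start block public
      open Run windmill σ start adversary

      module _ (legal : ∀ t → LegalMove windmill (adversary t) (pos t) (pos (suc t))) where

        in-own-triangle : ∀ t a → ∃ λ b → pos t a ≡ ⟦ petal (owned a) b ⟧
        in-own-triangle zero    a = false , refl
        in-own-triangle (suc t) a =
          confined (pos t) (proj₂ (in-own-triangle t a))
                   (subst (λ al → Step windmill al (pos t a) (pos (suc t) a)) (adversary-reacts t) (legal t a))

        separated : ∀ t a → pos t zero ≢ pos t (suc a)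
        separated t a same =
          0≢1+n (inject≤-injective few few zero (suc a) (proj₁ (petal-injective (⟦⟧-injective petals-equal))))
          where
          open ≡-Reasoning
          petals-equal : ⟦ petal (owned zero) _ ⟧ ≡ ⟦ petal (owned (suc a)) _ ⟧
          petals-equal = begin
            ⟦ petal (owned zero) _ ⟧    ≡⟨ sym (proj₂ (in-own-triangle t zero)) ⟩
            pos t zero                  ≡⟨ same ⟩
            pos t (suc a)               ≡⟨ proj₂ (in-own-triangle t (suc a)) ⟩
            ⟦ petal (owned (suc a)) _ ⟧ ∎

        uninformed : ∀ t a → informed t (suc a) ≢ true
        uninformed zero    a ()
        uninformed (suc t) a =
          spread-isolated windmill (informed t) (pos (suc t)) (uninformed t a) source-only
          where
          source-only : ∀ b → informed t b ≡ true → pos (suc t) b ≢ pos (suc t) (suc a)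
          source-only zero    _          = separated (suc t) a
          source-only (suc b) informed-b = ⊥-elim (uninformed t b informed-b)

      never-all-informed : Fin k′ →
                           ¬ ((∀ t → LegalMove windmill (adversary t) (pos t) (pos (suc t))) × ∃ AllInformed)
      never-all-informed a (legal , t , everyone) = uninformed legal t a (everyone (suc a))

    unsolvable : Fin k′ → ¬ BroadcastSolvable windmill k′
    unsolvable a (σ , solves) =
      Against.never-all-informed σ a
        (solves start start-injective (Against.adversary σ) (block-connected ∘ proj₁ ∘ Against.play σ))

windmill-density : ∀ k q p → q < p → EdgeDensity≤ (Windmill.windmill k (k * q)) p q
windmill-density k q p q<p = begin
  (k * 2 + k + k * q) * q                              ≤⟨ m≤m+n _ _ ⟩
  (k * 2 + k + k * q) * q + suc (q + k * 2)            ≡⟨ count k q ⟩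
  suc q * suc (k * 2 + k * q)                          ≤⟨ *-monoˡ-≤ _ q<p ⟩
  p * suc (k * 2 + k * q)                              ∎
  where
  open ≤-Reasoning
  count : ∀ k q → (k * 2 + k + k * q) * q + suc (q + k * 2) ≡ suc q * suc (k * 2 + k * q)
  count = solve-∀


module Decreasing (U : ℕ → ℕ) where

  Within : ℕ → ℕ → Set
  Within r t = U (r + t) < U t ⊎ U t ≡ 0

  reaches-zero : ∀ {d} → (∀ t → Within d t) → ∃ λ t → U t ≡ 0
  reaches-zero {d} drops = search (U 0) 0 ≤-refl
    where
    search : ∀ b t → U t ≤ b → ∃ λ t → U t ≡ 0
    search zero    t bound = t , n≤0⇒n≡0 bound
    search (suc b) t bound with drops t
    ... | inj₁ smaller = search b (d + t) (s≤s⁻¹ (≤-trans smaller bound))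
    ... | inj₂ none    = t , none

  module _ (antitone : ∀ t → U (suc t) ≤ U t) where

    antitone-+ : ∀ s t → U (s + t) ≤ U t
    antitone-+ zero    t = ≤-refl
    antitone-+ (suc s) t = ≤-trans (antitone (s + t)) (antitone-+ s t)

    within-suc : ∀ {r t} → Within r t → Within (suc r) t
    within-suc {r} {t} (inj₁ smaller) = inj₁ (≤-<-trans (antitone (r + t)) smaller)
    within-suc         (inj₂ none)    = inj₂ none

    within-shift : ∀ {r t} → Within r (suc t) → Within (suc r) t
    within-shift {r} {t} (inj₁ smaller) =
      inj₁ (subst (λ s → U s < U t) (+-suc r t) (<-≤-trans smaller (antitone t)))
    within-shift {r} {t} (inj₂ none) with U t
    ... | zero  = inj₂ refl
    ... | suc _ = inj₁ (subst (_< suc _) (sym vanished) (s≤s z≤n))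
      where
      vanished : U (suc r + t) ≡ 0
      vanished = n≤0⇒n≡0 (begin
        U (suc r + t)  ≡⟨ cong U (sym (+-suc r t)) ⟩
        U (r + suc t)  ≤⟨ antitone-+ r (suc t) ⟩
        U (suc t)      ≡⟨ none ⟩
        0              ∎)
        where open ≤-Reasoning

module Gathering (k L k′ : ℕ) where
  open Windmill k L

  Agent : Set
  Agent = Fin (suc k′)

  Config : Set
  Config = Pos windmill k′

  Edges : Set
  Edges = EdgeSet windmill

  Place : Set
  Place = Fin (Graph.n windmill)

  Meeting : Knowledge (suc k′) → Config → Edges → Set
  Meeting I p al = ∃₂ λ x y → I x ≡ true × I y ≡ false × Meetable windmill al (p x) (p y)

  meeting? : ∀ I p al → Dec (Meeting I p al)
  meeting? I p al =
    any? λ x → any? λ y → (I x ≟ᵇ true) ×-dec (I y ≟ᵇ false) ×-dec meetable? windmill al (p x) (p y)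

  Follower : Config → Agent → Set
  Follower p z = ∃ λ y → y <ᶠ z × p y ≡ p z

  follower? : ∀ p z → Dec (Follower p z)
  follower? p z = any? λ y → (y <ᶠ? z) ×-dec (p y ≟ p z)

  -- A valid adversary never removes a stem, nor the rim next to a removed spoke, so these
  -- moves need no check.
  retreat-node : Edges → Bool → Node → Node
  retreat-node al follower hub         = hub
  retreat-node al follower (leaf j)    = hub
  retreat-node al follower (petal i b) =
    if al ⟦ spoke i b ⟧ₑ then hub else if follower then petal i (not b) else petal i b

  retreat : Config → Edges → Config
  retreat p al z = ⟦ retreat-node al (does (follower? p z)) (node (p z)) ⟧

  gather : Agent → Agent → Place → Config → Config
  gather x y w p a = if does (a ≟ x) ∨ does (a ≟ y) then w else p a

  move-by : ∀ {I p al} → Dec (Meeting I p al) → Config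
  move-by {p = p}      (yes (x , y , _ , _ , w , _)) = gather x y w p
  move-by {p = p} {al} (no _)                        = retreat p al

  -- Opaque: unfolding the decision procedure meeting? inside Run makes type checking explode.
  opaque
    move : Knowledge (suc k′) → Config → Edges → Config
    move I p al = move-by (meeting? I p al)

  opaque
    unfolding move

    move-by-meeting : ∀ I p al → move I p al ≡ move-by (meeting? I p al)
    move-by-meeting I p al = refl

  initial-knowledge : Knowledge (suc k′)
  initial-knowledge zero    = true
  initial-knowledge (suc _) = false

  knowledge : History windmill k′ → Config → Knowledge (suc k′)
  knowledge []             p = initial-knowledge
  knowledge ((q , _) ∷ h) p = spread windmill (knowledge h q) p

  strategy : Strategy windmill k′
  strategy h p al = move (knowledge h p) p al

  Occupied : Config → Node → Set
  Occupied p x = ∃ λ z → p z ≡ ⟦ x ⟧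

  occupied? : ∀ p x → Dec (Occupied p x)
  occupied? p x = any? λ z → p z ≟ ⟦ x ⟧

  Exposed : Config → Set
  Exposed p = (∃ λ j → Occupied p (leaf j))
            ⊎ (∃₂ λ i b → Occupied p (petal i b) × Occupied p (petal i (not b)))

  leader : ∀ p z → ∃ λ m → p m ≡ p z × ¬ Follower p m
  leader p z = descend z (<-wellFounded z)
    where
    descend : ∀ z → Acc _<ᶠ_ z → ∃ λ m → p m ≡ p z × ¬ Follower p m
    descend z (acc smaller) with follower? p z
    ... | no leads = z , refl , leads
    ... | yes (y , y<z , same) with descend y (smaller y<z)
    ... | m , at , leads = m , trans at same , leads

  gathered : ∀ x y w p {a} → a ≡ x ⊎ a ≡ y → gather x y w p a ≡ w
  gathered x y w p {a} which with a ≟ x | a ≟ y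
  ... | yes _  | _      = refl
  ... | no _   | yes _  = refl
  ... | no a≢x | no a≢y = ⊥-elim ([ a≢x , a≢y ] which)

  retreat-at : ∀ {al} p z x → p z ≡ ⟦ x ⟧ → retreat p al z ≡ ⟦ retreat-node al (does (follower? p z)) x ⟧
  retreat-at {al} p z x at =
    cong (λ v → ⟦ retreat-node al (does (follower? p z)) v ⟧) (trans (cong node at) (node⟦⟧ x))

  module _ {al : Edges} (connected : Connected windmill al) where

    spoke-retreats : ∀ p z {i b} → p z ≡ ⟦ petal i b ⟧ → al ⟦ spoke i b ⟧ₑ ≡ true →
                     retreat p al z ≡ ⟦ hub ⟧
    spoke-retreats p z {i} {b} at present rewrite retreat-at {al} p z (petal i b) at | present = refl

    leader-stays : ∀ p z {i b} → p z ≡ ⟦ petal i b ⟧ → al ⟦ spoke i b ⟧ₑ ≡ false → ¬ Follower p z →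
                   retreat p al z ≡ ⟦ petal i b ⟧
    leader-stays p z {i} {b} at absent leads
      rewrite retreat-at {al} p z (petal i b) at | absent | dec-false (follower? p z) leads = refl

    follower-crosses : ∀ p z {i b} → p z ≡ ⟦ petal i b ⟧ → al ⟦ spoke i b ⟧ₑ ≡ false → Follower p z →
                       retreat p al z ≡ ⟦ petal i (not b) ⟧
    follower-crosses p z {i} {b} at absent follows
      rewrite retreat-at {al} p z (petal i b) at | absent | dec-true (follower? p z) follows = refl

    retreat-node-step : ∀ f x → Step windmill al ⟦ x ⟧ ⟦ retreat-node al f x ⟧
    retreat-node-step f hub      = inj₁ refl
    retreat-node-step f (leaf j) = inj₂ (arc⁺ (stem-present connected j) stem-in)
    retreat-node-step f (petal i b) with al ⟦ spoke i b ⟧ₑ in present | f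
    ... | true  | _     = inj₂ (arc⁺ present spoke-in)
    ... | false | true  = inj₂ (arc⁺ (rim-present connected present) rim-cross)
    ... | false | false = inj₁ refl

    retreat-legal : ∀ p → LegalMove windmill al p (retreat p al)
    retreat-legal p z =
      subst (λ x → Step windmill al x (retreat p al z)) (⟦node⟧ (p z)) (retreat-node-step _ (node (p z)))

    gather-legal : ∀ {p x y w} → Step windmill al (p x) w → Step windmill al (p y) w →
                   LegalMove windmill al p (gather x y w p)
    gather-legal {x = x} {y} sx sy a with a ≟ x | a ≟ y
    ... | yes refl | _        = sx
    ... | no _     | yes refl = sy
    ... | no _     | no _     = inj₁ refl

    move-legal : ∀ I p → LegalMove windmill al p (move I p al)
    move-legal I p =
      subst (LegalMove windmill al p) (sym (move-by-meeting I p al)) (legal-by (meeting? I p al))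
      where
      legal-by : (d : Dec (Meeting I p al)) → LegalMove windmill al p (move-by d)
      legal-by (yes (_ , _ , _ , _ , _ , sx , sy)) = gather-legal sx sy
      legal-by (no _)                              = retreat-legal p

    hub-meets : ∀ {u} → u ≡ ⟦ hub ⟧ → ∀ v → Meetable windmill al u v
    hub-meets refl v = subst (Meetable windmill al ⟦ hub ⟧) (⟦node⟧ v) (meets (node v))
      where
      meets : ∀ x → Meetable windmill al ⟦ hub ⟧ ⟦ x ⟧
      meets hub      = ⟦ hub ⟧ , inj₁ refl , inj₁ refl
      meets (leaf j) = ⟦ hub ⟧ , inj₁ refl , retreat-node-step false (leaf j)
      meets (petal i b) with al ⟦ spoke i b ⟧ₑ in present
      ... | true  = ⟦ petal i b ⟧ , inj₂ (arc⁺ present spoke-out) , inj₁ refl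
      ... | false = ⟦ petal i (not b) ⟧ , inj₂ (arc⁺ (spoke-present connected present) spoke-out)
                                        , inj₂ (arc⁺ (rim-present connected present) rim-cross)

    exposed⇒hub : ∀ p → Exposed p → Occupied (retreat p al) hub
    exposed⇒hub p (inj₁ (j , z , at)) = z , retreat-at p z (leaf j) at
    exposed⇒hub p (inj₂ (i , b , (z , at) , (z′ , at′))) with al ⟦ spoke i b ⟧ₑ in present
    ... | true  = z , spoke-retreats p z at present
    ... | false = z′ , spoke-retreats p z′ at′ (spoke-present connected present)

    Stranded : Config → Agent → Set
    Stranded p z = ∃₂ λ i b → p z ≡ ⟦ petal i b ⟧ × al ⟦ spoke i b ⟧ₑ ≡ false

    stranded-node : ∀ f x → retreat-node al f x ≢ hub →
                    ∃₂ λ i b → x ≡ petal i b × al ⟦ spoke i b ⟧ₑ ≡ false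
    stranded-node f hub      away = ⊥-elim (away refl)
    stranded-node f (leaf j) away = ⊥-elim (away refl)
    stranded-node f (petal i b) away with al ⟦ spoke i b ⟧ₑ in present
    ... | true  = ⊥-elim (away refl)
    ... | false = i , b , refl , present

    stranded : ∀ p → ¬ Occupied (retreat p al) hub → ∀ z → Stranded p z
    stranded p vacant z
      with stranded-node (does (follower? p z)) (node (p z)) (λ at-hub → vacant (z , cong ⟦_⟧ at-hub))
    ... | i , b , at , absent = i , b , trans (sym (⟦node⟧ (p z))) (cong ⟦_⟧ at) , absent

    shared-triangle⇒exposed : ∀ p {z₁ z₂} → z₁ <ᶠ z₂ → (s₁ : Stranded p z₁) (s₂ : Stranded p z₂) →
                              proj₁ s₁ ≡ proj₁ s₂ → Exposed (retreat p al)
    shared-triangle⇒exposed p {z₁} {z₂} z₁<z₂ (i , b , at₁ , absent) (.i , b₂ , at₂ , absent₂) refl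
      with b ≟ᵇ b₂
    ... | no differ = ⊥-elim (not-¬ (spoke-present connected absent)
                                   (subst (λ c → al ⟦ spoke i c ⟧ₑ ≡ false) (¬-not (differ ∘ sym)) absent₂))
    ... | yes refl with leader p z₂
    ... | m , m-at , leads =
      inj₂ (i , b , (m , leader-stays p m (trans m-at at₂) absent leads)
                  , (z₂ , follower-crosses p z₂ at₂ absent (z₁ , z₁<z₂ , trans at₁ (sym at₂))))

    crowded⇒exposed : k < suc k′ → ∀ p → ¬ Occupied (retreat p al) hub → Exposed (retreat p al)
    crowded⇒exposed enough p vacant with pigeonhole enough (proj₁ ∘ stranded p vacant)
    ... | z₁ , z₂ , z₁<z₂ , same =
      shared-triangle⇒exposed p z₁<z₂ (stranded p vacant z₁) (stranded p vacant z₂) same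

    hub-or-exposed : k < suc k′ → ∀ p → Occupied (retreat p al) hub ⊎ Exposed (retreat p al)
    hub-or-exposed enough p with occupied? (retreat p al) hub
    ... | yes occupied = inj₁ occupied
    ... | no vacant    = inj₂ (crowded⇒exposed enough p vacant)

    module Round {I : Knowledge (suc k′)} (source : I zero ≡ true) (p : Config) where

      Progress : Set
      Progress = ignorance (spread windmill I (move I p al)) < ignorance I

      outcome : Progress ⊎ (¬ Meeting I p al × move I p al ≡ retreat p al)
      outcome = subst Outcome (sym (move-by-meeting I p al)) (by (meeting? I p al))
        where
        Outcome : Config → Set
        Outcome q = ignorance (spread windmill I q) < ignorance I ⊎ (¬ Meeting I p al × q ≡ retreat p al)
        by : (d : Dec (Meeting I p al)) → Outcome (move-by d)
        by (yes (x , y , Ix , Iy , w , _)) =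
          inj₁ (spread-progress windmill I (gather x y w p) Ix Iy
                 (trans (gathered x y w p (inj₁ refl)) (sym (gathered x y w p (inj₂ refl)))))
        by (no none) = inj₂ (none , refl)

      meeting-at-hub : Occupied p hub → ∀ {y} → I y ≡ false → Meeting I p al
      meeting-at-hub (z , at) {y} Iy with I z in Iz
      ... | true  = z , y , Iz , Iy , hub-meets at (p y)
      ... | false = zero , z , source , Iz , map₂ swap (hub-meets at (p zero))

      hub-round : Occupied p hub → Progress ⊎ ignorance I ≡ 0
      hub-round occupied = by (any? λ y → I y ≟ᵇ false)
        where
        by : Dec (∃ λ y → I y ≡ false) → Progress ⊎ ignorance I ≡ 0
        by (no none)      = inj₂ (ignorance≡0⁺ λ a → ¬-not (none ∘ (a ,_)))
        by (yes (y , Iy)) = Sum.map₂ (λ no-meeting → ⊥-elim (proj₁ no-meeting (meeting-at-hub occupied Iy))) outcome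

      exposed-round : Exposed p → Progress ⊎ Occupied (move I p al) hub
      exposed-round exposed =
        Sum.map₂ (λ no-meeting → subst (λ q → Occupied q hub) (sym (proj₂ no-meeting)) (exposed⇒hub p exposed)) outcome

      crowded-round : k < suc k′ → Progress ⊎ Occupied (move I p al) hub ⊎ Exposed (move I p al)
      crowded-round enough =
        Sum.map₂ (λ no-meeting → subst (λ q → Occupied q hub ⊎ Exposed q) (sym (proj₂ no-meeting)) (hub-or-exposed enough p))
                 outcome

  module Play (p₀ : Config) (A : Adversary windmill) (valid : ValidAdversary windmill A) where
    open Run windmill strategy p₀ A

    known : ℕ → Knowledge (suc k′)
    known t = knowledge (proj₂ (state t)) (pos t)

    known-correct : ∀ t a → known t a ≡ informed t a
    known-correct zero    zero    = refl
    known-correct zero    (suc a) = refl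
    known-correct (suc t) a       = spread-cong windmill (pos (suc t)) (known-correct t) a

    source-known : ∀ t → known t zero ≡ true
    source-known zero    = refl
    source-known (suc t) = spread-⊇ windmill (known t) (pos (suc t)) (source-known t)

    legal : ∀ t → LegalMove windmill (A t) (pos t) (pos (suc t))
    legal t = move-legal (valid t) (known t) (pos t)

    U : ℕ → ℕ
    U t = ignorance (known t)

    antitone : ∀ t → U (suc t) ≤ U t
    antitone t = ignorance-antitone (spread-⊇ windmill (known t) (pos (suc t)))

    open Decreasing U

    module R (t : ℕ) = Round (valid t) {I = known t} (source-known t) (pos t)

    hub-within : ∀ t → Occupied (pos t) hub → Within 1 t
    hub-within t = R.hub-round t

    exposed-within : ∀ t → Exposed (pos t) → Within 2 t
    exposed-within t exposed =
      [ within-suc antitone {1} {t} ∘ inj₁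
      , within-shift antitone {1} {t} ∘ hub-within (suc t)
      ]′ (R.exposed-round t exposed)

    always-within : k < suc k′ → ∀ t → Within 3 t
    always-within enough t =
      [ within-suc antitone {2} {t} ∘ within-suc antitone {1} {t} ∘ inj₁
      , [ within-suc antitone {2} {t} ∘ within-shift antitone {1} {t} ∘ hub-within (suc t)
        , within-shift antitone {2} {t} ∘ exposed-within (suc t)
        ]′
      ]′ (R.crowded-round t enough)

    eventually-all-informed : k < suc k′ → ∃ AllInformed
    eventually-all-informed enough = all-informed-at (reaches-zero {3} (always-within enough))
      where
      all-informed-at : (∃ λ t → U t ≡ 0) → ∃ AllInformed
      all-informed-at (t , none) = t , λ a → trans (sym (known-correct t a)) (ignorance≡0⁻ none a)

  solvable : k ≤ k′ → BroadcastSolvable windmill k′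
  solvable enough = strategy , λ p₀ _ A valid →
    Play.legal p₀ A valid , Play.eventually-all-informed p₀ A valid (s≤s enough)

theorem8 : ∀ (k : ℕ) → 1 ≤ k → ∀ (p q : ℕ) → 0 < q → q < p →
    Σ Graph λ G → Connected G (allEdges G) × EdgeDensity≤ G p q ×
    (∀ (k′ : ℕ) → 1 ≤ k′ → (BroadcastSolvable G k′ ⇔ k ≤ k′))
theorem8 k _ p q _ q<p =
  windmill , windmill-connected , windmill-density k q p q<p ,
  λ k′ k′≥1 → mk⇔ (needs-k k′≥1) (Gathering.solvable k (k * q) k′)
  where
  open Windmill k (k * q)
  needs-k : ∀ {k′} → 1 ≤ k′ → BroadcastSolvable windmill k′ → k ≤ k′
  needs-k {suc _} _ solvable = ≮⇒≥ λ few → Blocking.unsolvable few zero solvable
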